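{- For all ultrafilters $\mathcal{U},\mathcal{V}$ on $\mathbb{N}$, both $\mathcal{U}$ and $\mathcal{V}$ are finitely embeddable in $\mathcal{U}\oplus\mathcal{V}$.
   Context: Here $0\in\mathbb{N}$. For $A,B\subseteq\mathbb{N}$, $A$ is finitely embeddable in $B$ ($A\leq_{fe}B$) if for every finite $F\subseteq A$ there is $n\in\mathbb{N}$ with $n+F\subseteq B$. For ultrafilters $\mathcal{U},\mathcal{V}$ on $\mathbb{N}$, $\mathcal{U}$ is finitely embeddable in $\mathcal{V}$ ($\mathcal{U}\trianglelefteq_{fe}\mathcal{V}$) if for every $B\in\mathcal{V}$ there is $A\in\mathcal{U}$ with $A\leq_{fe}B$. $A\in\mathcal{U}\oplus\mathcal{V}$ iff $\{n:\{m:n+m\in A\}\in\mathcal{V}\}\in\mathcal{U}$. -}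

module Defs where

open import Level using (0ℓ)
open import Data.Nat using (ℕ; _+_)
open import Data.Product using (Σ; ∃; _×_)
open import Data.Sum using (_⊎_)
open import Data.List using (List)
open import Data.List.Relation.Unary.All using (All)
open import Relation.Unary using (Pred; _⊆_; _∩_; ∁; U)

Subset : Set₁
Subset = Pred ℕ 0ℓ

Family : Set₁
Family = Subset → Set

-- Ultrafilter on ℕ.  Properness is stated as "every member is inhabited"
-- (classically equivalent to ∅ ∉ 𝒰).
record IsUltrafilter (𝒰 : Family) : Set₁ where
  field
    whole   : 𝒰 U
    proper  : ∀ A → 𝒰 A → ∃ λ n → A n
    upward  : ∀ A B → A ⊆ B → 𝒰 A → 𝒰 B
    meet    : ∀ A B → 𝒰 A → 𝒰 B → 𝒰 (A ∩ B)
    ultra   : ∀ A → 𝒰 A ⊎ 𝒰 (∁ A)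

ShiftIn : ℕ → List ℕ → Subset → Set
ShiftIn n F B = All (λ x → B (n + x)) F

_≤fe_ : Subset → Subset → Set
A ≤fe B = ∀ (F : List ℕ) → All A F → ∃ λ n → ShiftIn n F B

_⊴fe_ : Family → Family → Set₁
𝒰 ⊴fe 𝒱 = ∀ (B : Subset) → 𝒱 B → Σ Subset λ A → 𝒰 A × (A ≤fe B)

_⊕_ : Family → Family → Family
(𝒰 ⊕ 𝒱) A = 𝒰 (λ n → 𝒱 (λ m → A (n + m)))

-- If B ∈ 𝒰 ⊕ 𝒱 then the set of n with B − n := {m : n + m ∈ B} ∈ 𝒱 lies in 𝒰.
-- For 𝒰: finitely many x in that set give finitely many members B − x of 𝒱,
-- whose intersection contains some m, and then m + F ⊆ B.
-- For 𝒱: that set is nonempty, and for any n in it B − n ∈ 𝒱 embeds in B via n.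
module Submission where

open import Defs
open import Data.Product using (_×_; _,_)
open import Data.List using (List; []; _∷_)
open import Data.List.Relation.Unary.All as All using (All; []; _∷_)
open import Data.Nat using (ℕ; _+_)
open import Data.Nat.Properties using (+-comm)
open import Relation.Binary.PropositionalEquality using (subst)

shift : ℕ → Subset → Subset
shift n B m = B (n + m)

shift-≤fe : ∀ n B → shift n B ≤fe B
shift-≤fe n B F F⊆ = n , F⊆

module _ {𝒱 : Family} (𝒱-ultra : IsUltrafilter 𝒱) where
  open IsUltrafilter 𝒱-ultra

  All-member : (P : ℕ → Subset) (F : List ℕ) →
    All (λ x → 𝒱 (P x)) F → 𝒱 (λ m → All (λ x → P x m) F)
  All-member P []      []         = upward _ _ (λ _ → []) whole
  All-member P (x ∷ F) (Px ∷ PF) =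
    upward _ _ (λ (p , ps) → p ∷ ps) (meet _ _ Px (All-member P F PF))

  large-fibres-≤fe : ∀ B → (λ n → 𝒱 (shift n B)) ≤fe B
  large-fibres-≤fe B F F⊆ with proper _ (All-member (λ x → shift x B) F F⊆)
  ... | m , m∈ = m , All.map (λ {x} → subst B (+-comm x m)) m∈

proposition4p4p9 : (𝒰 𝒱 : Family) → IsUltrafilter 𝒰 → IsUltrafilter 𝒱 →
    (𝒰 ⊴fe (𝒰 ⊕ 𝒱)) × (𝒱 ⊴fe (𝒰 ⊕ 𝒱))
proposition4p4p9 𝒰 𝒱 𝒰-ultra 𝒱-ultra = 𝒰⊴ , 𝒱⊴
  where
  𝒰⊴ : 𝒰 ⊴fe (𝒰 ⊕ 𝒱)
  𝒰⊴ B B∈ = _ , B∈ , large-fibres-≤fe 𝒱-ultra B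

  𝒱⊴ : 𝒱 ⊴fe (𝒰 ⊕ 𝒱)
  𝒱⊴ B B∈ with IsUltrafilter.proper 𝒰-ultra _ B∈
  ... | n , shift-n-B∈𝒱 = shift n B , shift-n-B∈𝒱 , shift-≤fe n B
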